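{- Let $G_1$ be a complete graph and $G_2$ an arbitrary graph on a disjoint vertex set. Then \[\varsigma_c(G_1\vee G_2)=\min\{|V(G_1)|+\varsigma(G_2),\ \theta_c(G_2),\ 1+\theta(G_2)\}.\]
   Context: Graphs are finite, simple, undirected. $G_1\vee G_2$ is the join: the disjoint union plus all edges between $V(G_1)$ and $V(G_2)$. $\varsigma(G)$ is the minimum size of a set $S\subseteq V(G)$ such that every component of $G-S$ is a clique; $\varsigma_c(G)$ is the minimum size of such a set with $G[S]$ additionally connected ($\infty$ if none exists). $\theta(G)$ is the minimum size of a set $S$ with $G-S$ a clique; $\theta_c(G)$ is the minimum size of such a set with $G[S]$ connected ($\infty$ if none exists). -}

module Defs where

open import Data.Nat using (ℕ; zero; suc; _+_; _≤_; _⊓_)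
open import Data.Bool using (Bool; true; false; T)
open import Data.Fin using (Fin; splitAt)
open import Data.Fin.Subset using (Subset; _∈_; ∁; ∣_∣)
open import Data.Sum using (_⊎_; inj₁; inj₂)
open import Data.Product using (Σ; _×_)
open import Data.Maybe using (Maybe; just; nothing)
open import Relation.Binary.PropositionalEquality using (_≡_; _≢_)
open import Relation.Nullary using (¬_)

record Graph (n : ℕ) : Set where
  field
    adj    : Fin n → Fin n → Bool
    sym    : ∀ u v → adj u v ≡ adj v u
    irrefl : ∀ u → adj u u ≡ false

open Graph public

Adj : ∀ {n} → Graph n → Fin n → Fin n → Set
Adj G u v = T (adj G u v)

IsComplete : ∀ {n} → Graph n → Set
IsComplete G = ∀ u v → u ≢ v → Adj G u v

-- Join G₁ ∨ G₂ on Fin (m + n): first m vertices are V(G₁), last n are V(G₂).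
joinAdj : ∀ {m n} → Graph m → Graph n → Fin (m + n) → Fin (m + n) → Bool
joinAdj {m} G₁ G₂ x y with splitAt m x | splitAt m y
... | inj₁ a | inj₁ b = adj G₁ a b
... | inj₂ a | inj₂ b = adj G₂ a b
... | inj₁ _ | inj₂ _ = true
... | inj₂ _ | inj₁ _ = true

joinSym : ∀ {m n} (G₁ : Graph m) (G₂ : Graph n) x y →
          joinAdj G₁ G₂ x y ≡ joinAdj G₁ G₂ y x
joinSym {m} G₁ G₂ x y with splitAt m x | splitAt m y
... | inj₁ a | inj₁ b = sym G₁ a b
... | inj₂ a | inj₂ b = sym G₂ a b
... | inj₁ _ | inj₂ _ = _≡_.refl
... | inj₂ _ | inj₁ _ = _≡_.refl

joinIrrefl : ∀ {m n} (G₁ : Graph m) (G₂ : Graph n) x →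
             joinAdj G₁ G₂ x x ≡ false
joinIrrefl {m} G₁ G₂ x with splitAt m x
... | inj₁ a = irrefl G₁ a
... | inj₂ a = irrefl G₂ a

_∨ᴳ_ : ∀ {m n} → Graph m → Graph n → Graph (m + n)
G₁ ∨ᴳ G₂ = record { adj = joinAdj G₁ G₂ ; sym = joinSym G₁ G₂ ; irrefl = joinIrrefl G₁ G₂ }

-- Walks in G staying inside the vertex set A (i.e. walks in G[A]).
data Path {n} (G : Graph n) (A : Subset n) : Fin n → Fin n → Set where
  here : ∀ {u} → u ∈ A → Path G A u u
  step : ∀ {u v w} → u ∈ A → Adj G u v → Path G A v w → Path G A u w

-- G[A] is connected (the empty set counts as connected).
Connected : ∀ {n} → Graph n → Subset n → Set
Connected G A = ∀ u v → u ∈ A → v ∈ A → Path G A u v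

IsClique : ∀ {n} → Graph n → Subset n → Set
IsClique G A = ∀ u v → u ∈ A → v ∈ A → u ≢ v → Adj G u v

-- Every component of G - S is a clique: any two distinct vertices in the
-- same component of G - S are adjacent.
ComponentsCliques : ∀ {n} → Graph n → Subset n → Set
ComponentsCliques G S = ∀ u v → Path G (∁ S) u v → u ≢ v → Adj G u v

-- ℕ ∪ {∞}
ℕ∞ : Set
ℕ∞ = Maybe ℕ

min∞ : ℕ∞ → ℕ∞ → ℕ∞
min∞ (just a) (just b) = just (a ⊓ b)
min∞ (just a) nothing  = just a
min∞ nothing  y        = y

-- MinSize P k : k is the minimum size of a set S with P S
-- (k = nothing, i.e. ∞, iff no such set exists).
MinSize : ∀ {n} → (Subset n → Set) → ℕ∞ → Set
MinSize P (just k) = Σ _ (λ S → P S × ∣ S ∣ ≡ k) × (∀ S → P S → k ≤ ∣ S ∣)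
MinSize P nothing  = ∀ S → ¬ P S

IsVarsigma : ∀ {n} → Graph n → ℕ → Set
IsVarsigma G k = MinSize (ComponentsCliques G) (just k)

IsVarsigmaC : ∀ {n} → Graph n → ℕ∞ → Set
IsVarsigmaC G k = MinSize (λ S → ComponentsCliques G S × Connected G S) k

IsTheta : ∀ {n} → Graph n → ℕ → Set
IsTheta G k = MinSize (λ S → IsClique G (∁ S)) (just k)

IsThetaC : ∀ {n} → Graph n → ℕ∞ → Set
IsThetaC G k = MinSize (λ S → IsClique G (∁ S) × Connected G S) k

{-# OPTIONS --safe #-}
module Submission where

-- Split a cut S of K ∨ G₂ along the two sides as S₁ ++ S₂. If S₁ covers K, then S is
-- connected for free and S₂ must be a cluster deletion set of G₂: size |K| + ς(G₂).
-- Otherwise a surviving vertex of K is adjacent to everything, so (K ∨ G₂) - S is connected,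
-- hence a single clique, i.e. G₂ - S₂ is a clique; then either S₁ is non-empty (size at least
-- 1 + θ(G₂)) or S = S₂ must be connected inside G₂ (size at least θ_c(G₂)). All three bounds
-- are attained: by K ∪ B, by C, and by {v} ∪ D for a vertex v of K.

open import Defs renaming (sym to adj-sym)
open import Level using (0ℓ)
open import Data.Nat using (ℕ; suc; _+_; _≤_)
open import Data.Nat.Properties using (≤-trans; ≤-antisym; ≤-reflexive; ⊓-sel; m⊓n≤m; m⊓n≤n; +-monoʳ-≤; +-monoˡ-≤)
open import Data.Bool using (true; T; not)
open import Data.Unit using (tt)
open import Data.Empty using (⊥-elim)
open import Data.Maybe using (just; nothing) renaming (map to mapMaybe)
open import Data.Sum using (inj₁; inj₂; [_,_]′)
open import Data.Product using (∃; ∃₂; _×_; _,_)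
open import Data.Fin using (Fin; zero; splitAt; _↑ˡ_; _↑ʳ_; _≟_)
open import Data.Fin.Properties using (splitAt-↑ˡ; splitAt-↑ʳ; splitAt⁻¹-↑ˡ; splitAt⁻¹-↑ʳ; ↑ʳ-injective)
open import Data.Fin.Subset using (Subset; _∈_; ∁; ∣_∣; ⊤; ⊥; inside; outside; ⁅_⁆; Empty)
open import Data.Fin.Subset.Properties using (nonempty?; Empty-unique; ⊆-antisym; ⊆⊤; ∈⊤; ∉⊥; x∈⁅x⁆; x∈⁅y⁆⇒x≡y; ∣⁅x⁆∣≡1; ∣⊤∣≡n; ∣⊥∣≡0; p⊆q⇒∣p∣≤∣q∣; x∉∁p⇒x∈p)
open import Data.Vec using ([]; _∷_; _++_; lookup)
import Data.Vec as Vec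
open import Data.Vec.Properties using (lookup-++ˡ; lookup-++ʳ; []=⇒lookup; lookup⇒[]=; map-++; map-replicate)
open import Function using (_∘_)
open import Relation.Binary.PropositionalEquality using (_≡_; _≢_; refl; sym; trans; cong; subst; subst₂)
open import Relation.Nullary using (yes; no; ¬_)
open import Relation.Unary using (Pred; _∪_; _⊆_)

IsMinimum : Pred ℕ 0ℓ → ℕ∞ → Set
IsMinimum A (just k) = A k × (∀ {j} → A j → k ≤ j)
IsMinimum A nothing  = ∀ {j} → ¬ A j

IsMinimum-unique : ∀ {A a b} → IsMinimum A a → IsMinimum A b → a ≡ b
IsMinimum-unique {a = just k}  {just l}  (Ak , k≤) (Al , l≤) = cong just (≤-antisym (k≤ Al) (l≤ Ak))
IsMinimum-unique {a = just k}  {nothing} (Ak , _)  none      = ⊥-elim (none Ak)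
IsMinimum-unique {a = nothing} {just l}  none      (Al , _)  = ⊥-elim (none Al)
IsMinimum-unique {a = nothing} {nothing} _         _         = refl

IsMinimum-∪ : ∀ {A B a b} → IsMinimum A a → IsMinimum B b → IsMinimum (A ∪ B) (min∞ a b)
IsMinimum-∪ {A} {B} {just k} {just l} (Ak , k≤) (Bl , l≤) =
  [ (λ e → inj₁ (subst A (sym e) Ak)) , (λ e → inj₂ (subst B (sym e) Bl)) ]′ (⊓-sel k l) ,
  λ { (inj₁ Aj) → ≤-trans (m⊓n≤m k l) (k≤ Aj) ; (inj₂ Bj) → ≤-trans (m⊓n≤n k l) (l≤ Bj) }
IsMinimum-∪ {a = just k}  {nothing} (Ak , k≤) none =
  inj₁ Ak , λ { (inj₁ Aj) → k≤ Aj ; (inj₂ Bj) → ⊥-elim (none Bj) }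
IsMinimum-∪ {a = nothing} {just l}  none (Bl , l≤) =
  inj₂ Bl , λ { (inj₁ Aj) → ⊥-elim (none Aj) ; (inj₂ Bj) → l≤ Bj }
IsMinimum-∪ {a = nothing} {nothing} noneA noneB =
  λ { (inj₁ Aj) → noneA Aj ; (inj₂ Bj) → noneB Bj }

_+ˢ_ : ℕ → Pred ℕ 0ℓ → Pred ℕ 0ℓ
(o +ˢ A) k = ∃ λ j → A j × o + j ≡ k

IsMinimum-+ˢ : ∀ o {A a} → IsMinimum A a → IsMinimum (o +ˢ A) (mapMaybe (o +_) a)
IsMinimum-+ˢ o {a = just k}  (Ak , k≤) = (k , Ak , refl) , λ { (j , Aj , refl) → +-monoʳ-≤ o (k≤ Aj) }
IsMinimum-+ˢ o {a = nothing} none      = λ { (j , Aj , _) → none Aj }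

IsMinimum-coinitial : ∀ {A B a} → A ⊆ B → (∀ {k} → B k → ∃ λ j → A j × j ≤ k) →
                    IsMinimum A a → IsMinimum B a
IsMinimum-coinitial {a = just k}  A⊆B dominated (Ak , k≤) =
  A⊆B Ak , λ Bj → let (i , Ai , i≤j) = dominated Bj in ≤-trans (k≤ Ai) i≤j
IsMinimum-coinitial {a = nothing} A⊆B dominated none =
  λ Bj → let (i , Ai , _) = dominated Bj in none Ai

Sizes : ∀ {n} → Pred (Subset n) 0ℓ → Pred ℕ 0ℓ
Sizes P k = ∃ λ S → P S × ∣ S ∣ ≡ k

MinSize⇒IsMinimum : ∀ {n} {P : Pred (Subset n) 0ℓ} {k} → MinSize P k → IsMinimum (Sizes P) k
MinSize⇒IsMinimum {k = just k}  (witness , minimal) = witness , λ { (S , PS , refl) → minimal S PS }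
MinSize⇒IsMinimum {k = nothing} none                = λ { (S , PS , _) → none S PS }

∈-resp-lookup : ∀ {k l} {p : Subset k} {q : Subset l} {x y} →
                lookup p x ≡ lookup q y → x ∈ p → y ∈ q
∈-resp-lookup {q = q} {y = y} eq x∈p = lookup⇒[]= y q (trans (sym eq) ([]=⇒lookup x∈p))

module _ {m n} (p : Subset m) (q : Subset n) where

  ∈-++⁺ˡ : ∀ {i} → i ∈ p → i ↑ˡ n ∈ p ++ q
  ∈-++⁺ˡ = ∈-resp-lookup (sym (lookup-++ˡ p q _))

  ∈-++⁻ˡ : ∀ {i} → i ↑ˡ n ∈ p ++ q → i ∈ p
  ∈-++⁻ˡ = ∈-resp-lookup (lookup-++ˡ p q _)

  ∈-++⁺ʳ : ∀ {j} → j ∈ q → m ↑ʳ j ∈ p ++ q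
  ∈-++⁺ʳ = ∈-resp-lookup (sym (lookup-++ʳ p q _))

  ∈-++⁻ʳ : ∀ {j} → m ↑ʳ j ∈ p ++ q → j ∈ q
  ∈-++⁻ʳ = ∈-resp-lookup (lookup-++ʳ p q _)

  ∁-++ : ∁ (p ++ q) ≡ ∁ p ++ ∁ q
  ∁-++ = map-++ not p q

∣p++q∣≡∣p∣+∣q∣ : ∀ {m n} (p : Subset m) (q : Subset n) → ∣ p ++ q ∣ ≡ ∣ p ∣ + ∣ q ∣
∣p++q∣≡∣p∣+∣q∣ []            q = refl
∣p++q∣≡∣p∣+∣q∣ (inside  ∷ p) q = cong suc (∣p++q∣≡∣p∣+∣q∣ p q)
∣p++q∣≡∣p∣+∣q∣ (outside ∷ p) q = ∣p++q∣≡∣p∣+∣q∣ p q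

∁⊤≡⊥ : ∀ {n} → ∁ (⊤ {n}) ≡ ⊥
∁⊤≡⊥ {n} = map-replicate not true n

Empty-∁⇒≡⊤ : ∀ {n} {p : Subset n} → Empty (∁ p) → p ≡ ⊤
Empty-∁⇒≡⊤ empty = ⊆-antisym ⊆⊤ (λ {x} _ → x∉∁p⇒x∈p (λ x∈∁p → empty (x , x∈∁p)))

x∈p⇒1≤∣p∣ : ∀ {n} {p : Subset n} {x} → x ∈ p → 1 ≤ ∣ p ∣
x∈p⇒1≤∣p∣ {p = p} {x} x∈p =
  subst (_≤ ∣ p ∣) (∣⁅x⁆∣≡1 x) (p⊆q⇒∣p∣≤∣q∣ (λ y∈⁅x⁆ → subst (_∈ p) (sym (x∈⁅y⁆⇒x≡y _ y∈⁅x⁆)) x∈p))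

∁⊤++q≡⊥++∁q : ∀ {m n} (q : Subset n) → ∁ (⊤ {m} ++ q) ≡ ⊥ ++ ∁ q
∁⊤++q≡⊥++∁q q = trans (∁-++ ⊤ q) (cong (_++ ∁ q) ∁⊤≡⊥)

∣⊤++q∣≡m+∣q∣ : ∀ {m n} (q : Subset n) → ∣ ⊤ {m} ++ q ∣ ≡ m + ∣ q ∣
∣⊤++q∣≡m+∣q∣ {m} q = trans (∣p++q∣≡∣p∣+∣q∣ (⊤ {m}) q) (cong (_+ ∣ q ∣) (∣⊤∣≡n m))

∣⊥++q∣≡∣q∣ : ∀ {m n} (q : Subset n) → ∣ ⊥ {m} ++ q ∣ ≡ ∣ q ∣
∣⊥++q∣≡∣q∣ {m} q = trans (∣p++q∣≡∣p∣+∣q∣ (⊥ {m}) q) (cong (_+ ∣ q ∣) (∣⊥∣≡0 m))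

∣⁅x⁆++q∣≡1+∣q∣ : ∀ {m n} (x : Fin m) (q : Subset n) → ∣ ⁅ x ⁆ ++ q ∣ ≡ 1 + ∣ q ∣
∣⁅x⁆++q∣≡1+∣q∣ x q = trans (∣p++q∣≡∣p∣+∣q∣ ⁅ x ⁆ q) (cong (_+ ∣ q ∣) (∣⁅x⁆∣≡1 x))

ConnectedClusterDeletion CliqueDeletion ConnectedCliqueDeletion : ∀ {n} → Graph n → Pred (Subset n) 0ℓ
ConnectedClusterDeletion G S = ComponentsCliques G S × Connected G S
CliqueDeletion G S = IsClique G (∁ S)
ConnectedCliqueDeletion G S = CliqueDeletion G S × Connected G S

Universal : ∀ {n} → Graph n → Fin n → Set
Universal G z = ∀ x → z ≢ x → Adj G z x

Adj-sym : ∀ {n} (G : Graph n) {x y} → Adj G x y → Adj G y x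
Adj-sym G {x} {y} = subst T (adj-sym G x y)

module _ {n} {G : Graph n} {A : Subset n} where

  source∈ : ∀ {u v} → Path G A u v → u ∈ A
  source∈ (here u∈A)     = u∈A
  source∈ (step u∈A _ _) = u∈A

  target∈ : ∀ {u v} → Path G A u v → v ∈ A
  target∈ (here v∈A)   = v∈A
  target∈ (step _ _ p) = target∈ p

  _++ᵖ_ : ∀ {u v w} → Path G A u v → Path G A v w → Path G A u w
  here _       ++ᵖ q = q
  step u∈A e p ++ᵖ q = step u∈A e (p ++ᵖ q)

  module _ {z} (z∈A : z ∈ A) (universal : Universal G z) where

    path-from-universal : ∀ {u} → u ∈ A → Path G A z u
    path-from-universal {u} u∈A with z ≟ u
    ... | yes refl = here z∈A
    ... | no z≢u   = step z∈A (universal u z≢u) (here u∈A)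

    path-to-universal : ∀ {u} → u ∈ A → Path G A u z
    path-to-universal {u} u∈A with u ≟ z
    ... | yes refl = here u∈A
    ... | no u≢z   = step u∈A (Adj-sym G (universal u (u≢z ∘ sym))) (here z∈A)

    universal⇒connected : Connected G A
    universal⇒connected u v u∈A v∈A = path-to-universal u∈A ++ᵖ path-from-universal v∈A

cliqueDeletion⇒componentsCliques : ∀ {n} {G : Graph n} {S} →
                                   CliqueDeletion G S → ComponentsCliques G S
cliqueDeletion⇒componentsCliques clique u v p = clique u v (source∈ p) (target∈ p)

universal∈∁⇒cliqueDeletion : ∀ {n} {G : Graph n} {S z} → z ∈ ∁ S → Universal G z →
                             ComponentsCliques G S → CliqueDeletion G S
universal∈∁⇒cliqueDeletion z∈∁S universal cc u v u∈∁S v∈∁S =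
  cc u v (universal⇒connected z∈∁S universal u v u∈∁S v∈∁S)

data Side (m : ℕ) {n : ℕ} : Fin (m + n) → Set where
  left  : ∀ i → Side m (i ↑ˡ n)
  right : ∀ j → Side m (m ↑ʳ j)

side : ∀ m {n} (x : Fin (m + n)) → Side m x
side m x with splitAt m x in eq
... | inj₁ i = subst (Side m) (splitAt⁻¹-↑ˡ eq) (left i)
... | inj₂ j = subst (Side m) (splitAt⁻¹-↑ʳ eq) (right j)

module Join {m n} (G₁ : Graph m) (G₂ : Graph n) where

  H : Graph (m + n)
  H = G₁ ∨ᴳ G₂

  adj-↑ˡ-↑ˡ : ∀ i j → adj H (i ↑ˡ n) (j ↑ˡ n) ≡ adj G₁ i j
  adj-↑ˡ-↑ˡ i j rewrite splitAt-↑ˡ m i n | splitAt-↑ˡ m j n = refl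

  adj-↑ˡ-↑ʳ : ∀ i j → adj H (i ↑ˡ n) (m ↑ʳ j) ≡ true
  adj-↑ˡ-↑ʳ i j rewrite splitAt-↑ˡ m i n | splitAt-↑ʳ m n j = refl

  adj-↑ʳ-↑ʳ : ∀ i j → adj H (m ↑ʳ i) (m ↑ʳ j) ≡ adj G₂ i j
  adj-↑ʳ-↑ʳ i j rewrite splitAt-↑ʳ m n i | splitAt-↑ʳ m n j = refl

  Adj-↑ʳ⁺ : ∀ {i j} → Adj G₂ i j → Adj H (m ↑ʳ i) (m ↑ʳ j)
  Adj-↑ʳ⁺ {i} {j} = subst T (sym (adj-↑ʳ-↑ʳ i j))

  Adj-↑ʳ⁻ : ∀ {i j} → Adj H (m ↑ʳ i) (m ↑ʳ j) → Adj G₂ i j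
  Adj-↑ʳ⁻ {i} {j} = subst T (adj-↑ʳ-↑ʳ i j)

  ↑ˡ-universal : IsComplete G₁ → ∀ i → Universal H (i ↑ˡ n)
  ↑ˡ-universal complete i x i≢x with side m x
  ... | left j  = subst T (sym (adj-↑ˡ-↑ˡ i j)) (complete i j (i≢x ∘ cong (_↑ˡ n)))
  ... | right j = subst T (sym (adj-↑ˡ-↑ʳ i j)) tt

  ++-isClique : IsComplete G₁ → ∀ A₁ {A₂} → IsClique G₂ A₂ → IsClique H (A₁ ++ A₂)
  ++-isClique complete A₁ {A₂} clique x y x∈ y∈ x≢y with side m x | side m y
  ... | left i  | _       = ↑ˡ-universal complete i y x≢y
  ... | right _ | left j  = Adj-sym H (↑ˡ-universal complete j _ (x≢y ∘ sym))
  ... | right i | right j =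
    Adj-↑ʳ⁺ (clique i j (∈-++⁻ʳ A₁ A₂ x∈) (∈-++⁻ʳ A₁ A₂ y∈) (x≢y ∘ cong (m ↑ʳ_)))

  isClique-++⁻ʳ : ∀ A₁ {A₂} → IsClique H (A₁ ++ A₂) → IsClique G₂ A₂
  isClique-++⁻ʳ A₁ {A₂} clique u v u∈ v∈ u≢v =
    Adj-↑ʳ⁻ (clique _ _ (∈-++⁺ʳ A₁ A₂ u∈) (∈-++⁺ʳ A₁ A₂ v∈) (u≢v ∘ ↑ʳ-injective m u v))

  ↑ʳ-path : ∀ A₁ {A₂ u v} → Path G₂ A₂ u v → Path H (A₁ ++ A₂) (m ↑ʳ u) (m ↑ʳ v)
  ↑ʳ-path A₁ {A₂} (here u∈)     = here (∈-++⁺ʳ A₁ A₂ u∈)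
  ↑ʳ-path A₁ {A₂} (step u∈ e p) = step (∈-++⁺ʳ A₁ A₂ u∈) (Adj-↑ʳ⁺ e) (↑ʳ-path A₁ p)

  ⊥++-path⁻ : ∀ {A₂ x y} → Path H (⊥ ++ A₂) x y →
              ∃₂ λ u v → m ↑ʳ u ≡ x × m ↑ʳ v ≡ y × Path G₂ A₂ u v
  ⊥++-path⁻ {A₂} {x} (here x∈) with side m x
  ... | left i  = ⊥-elim (∉⊥ (∈-++⁻ˡ ⊥ A₂ x∈))
  ... | right u = u , u , refl , refl , here (∈-++⁻ʳ ⊥ A₂ x∈)
  ⊥++-path⁻ {A₂} {x} (step x∈ e p) with side m x | ⊥++-path⁻ p
  ... | left i  | _                       = ⊥-elim (∉⊥ (∈-++⁻ˡ ⊥ A₂ x∈))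
  ... | right u | _ , v , refl , refl , q = u , v , refl , refl , step (∈-++⁻ʳ ⊥ A₂ x∈) (Adj-↑ʳ⁻ e) q

  componentsCliques-++⁻ʳ : ∀ A₁ {B} → ComponentsCliques H (A₁ ++ B) → ComponentsCliques G₂ B
  componentsCliques-++⁻ʳ A₁ {B} cc u v p u≢v =
    Adj-↑ʳ⁻ (cc _ _ (subst (λ A → Path H A _ _) (sym (∁-++ A₁ B)) (↑ʳ-path (∁ A₁) p))
                    (u≢v ∘ ↑ʳ-injective m u v))

  ⊤++-componentsCliques : ∀ {B} → ComponentsCliques G₂ B → ComponentsCliques H (⊤ ++ B)
  ⊤++-componentsCliques {B} cc x y p x≢y
    with ⊥++-path⁻ (subst (λ A → Path H A x y) (∁⊤++q≡⊥++∁q B) p)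
  ... | u , v , refl , refl , q = Adj-↑ʳ⁺ (cc u v q (x≢y ∘ cong (m ↑ʳ_)))

  ⊥++-connected : ∀ {C} → Connected G₂ C → Connected H (⊥ ++ C)
  ⊥++-connected {C} connected x y x∈ y∈ with side m x | side m y
  ... | left i  | _       = ⊥-elim (∉⊥ (∈-++⁻ˡ ⊥ C x∈))
  ... | right _ | left j  = ⊥-elim (∉⊥ (∈-++⁻ˡ ⊥ C y∈))
  ... | right u | right v = ↑ʳ-path ⊥ (connected u v (∈-++⁻ʳ ⊥ C x∈) (∈-++⁻ʳ ⊥ C y∈))

  ⊥++-connected⁻ : ∀ {C} → Connected H (⊥ ++ C) → Connected G₂ C
  ⊥++-connected⁻ {C} connected u v u∈ v∈
    with ⊥++-path⁻ (connected _ _ (∈-++⁺ʳ ⊥ C u∈) (∈-++⁺ʳ ⊥ C v∈))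
  ... | u′ , v′ , u′≡u , v′≡v , q =
    subst₂ (Path G₂ C) (↑ʳ-injective m u′ u u′≡u) (↑ʳ-injective m v′ v v′≡v) q

  ++-cliqueDeletion : IsComplete G₁ → ∀ A₁ {D} → CliqueDeletion G₂ D → CliqueDeletion H (A₁ ++ D)
  ++-cliqueDeletion complete A₁ {D} clique =
    subst (IsClique H) (sym (∁-++ A₁ D)) (++-isClique complete (∁ A₁) clique)

  cliqueDeletion-++⁻ʳ : ∀ A₁ {D} → CliqueDeletion H (A₁ ++ D) → CliqueDeletion G₂ D
  cliqueDeletion-++⁻ʳ A₁ {D} clique = isClique-++⁻ʳ (∁ A₁) (subst (IsClique H) (∁-++ A₁ D) clique)

module CliqueJoin {m n} {G₁ : Graph (suc m)} {G₂ : Graph n} (complete : IsComplete G₁) where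
  open Join G₁ G₂

  Families : Pred ℕ 0ℓ
  Families = ((suc m +ˢ Sizes (ComponentsCliques G₂)) ∪ Sizes (ConnectedCliqueDeletion G₂))
           ∪ (1 +ˢ Sizes (CliqueDeletion G₂))

  ↑ˡ∈⇒connected : ∀ {S i} → i ↑ˡ n ∈ S → Connected H S
  ↑ˡ∈⇒connected {i = i} i∈S = universal⇒connected i∈S (↑ˡ-universal complete i)

  ⊤++-connectedClusterDeletion : ∀ {B} → ComponentsCliques G₂ B →
                                 ConnectedClusterDeletion H (⊤ ++ B)
  ⊤++-connectedClusterDeletion {B} cc =
    ⊤++-componentsCliques cc , ↑ˡ∈⇒connected (∈-++⁺ˡ ⊤ B (∈⊤ {x = zero}))

  ⊥++-connectedClusterDeletion : ∀ {C} → ConnectedCliqueDeletion G₂ C →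
                                 ConnectedClusterDeletion H (⊥ ++ C)
  ⊥++-connectedClusterDeletion (clique , connected) =
    cliqueDeletion⇒componentsCliques (++-cliqueDeletion complete ⊥ clique) , ⊥++-connected connected

  ⁅⁆++-connectedClusterDeletion : ∀ i {D} → CliqueDeletion G₂ D →
                                  ConnectedClusterDeletion H (⁅ i ⁆ ++ D)
  ⁅⁆++-connectedClusterDeletion i {D} clique =
    cliqueDeletion⇒componentsCliques (++-cliqueDeletion complete ⁅ i ⁆ clique) ,
    ↑ˡ∈⇒connected (∈-++⁺ˡ ⁅ i ⁆ D (x∈⁅x⁆ i))

  families⊆sizes : Families ⊆ Sizes (ConnectedClusterDeletion H)
  families⊆sizes (inj₁ (inj₁ (_ , (B , cc , refl) , refl))) =
    ⊤ ++ B , ⊤++-connectedClusterDeletion cc , ∣⊤++q∣≡m+∣q∣ B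
  families⊆sizes (inj₁ (inj₂ (C , deletion , refl))) =
    ⊥ ++ C , ⊥++-connectedClusterDeletion deletion , ∣⊥++q∣≡∣q∣ {suc m} C
  families⊆sizes (inj₂ (_ , (D , clique , refl) , refl)) =
    ⁅ zero ⁆ ++ D , ⁅⁆++-connectedClusterDeletion zero clique , ∣⁅x⁆++q∣≡1+∣q∣ (zero {m}) D

  ↑ˡ∈∁⇒cliqueDeletion : ∀ {S₁ S₂ i} → i ∈ ∁ S₁ → ComponentsCliques H (S₁ ++ S₂) →
                        CliqueDeletion G₂ S₂
  ↑ˡ∈∁⇒cliqueDeletion {S₁} {S₂} {i} i∈∁S₁ cc =
    cliqueDeletion-++⁻ʳ S₁ (universal∈∁⇒cliqueDeletion i∈∁S (↑ˡ-universal complete i) cc)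
    where
    i∈∁S : i ↑ˡ n ∈ ∁ (S₁ ++ S₂)
    i∈∁S = subst (i ↑ˡ n ∈_) (sym (∁-++ S₁ S₂)) (∈-++⁺ˡ (∁ S₁) (∁ S₂) i∈∁S₁)

  ++-dominated : ∀ S₁ S₂ → ConnectedClusterDeletion H (S₁ ++ S₂) →
                 ∃ λ j → Families j × j ≤ ∣ S₁ ++ S₂ ∣
  ++-dominated S₁ S₂ (cc , connected) with nonempty? (∁ S₁)
  ... | no ∁S₁-empty rewrite Empty-∁⇒≡⊤ ∁S₁-empty =
    _ , inj₁ (inj₁ (_ , (S₂ , componentsCliques-++⁻ʳ ⊤ cc , refl) , refl)) ,
    ≤-reflexive (sym (∣⊤++q∣≡m+∣q∣ S₂))
  ... | yes (i , i∈∁S₁) with nonempty? S₁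
  ...   | yes (j , j∈S₁) =
    _ , inj₂ (_ , (S₂ , ↑ˡ∈∁⇒cliqueDeletion i∈∁S₁ cc , refl) , refl) ,
    subst (1 + ∣ S₂ ∣ ≤_) (sym (∣p++q∣≡∣p∣+∣q∣ S₁ S₂)) (+-monoˡ-≤ ∣ S₂ ∣ (x∈p⇒1≤∣p∣ j∈S₁))
  ...   | no S₁-empty rewrite Empty-unique S₁-empty =
    _ , inj₁ (inj₂ (S₂ , (↑ˡ∈∁⇒cliqueDeletion i∈∁S₁ cc , ⊥++-connected⁻ connected) , refl)) ,
    ≤-reflexive (sym (∣⊥++q∣≡∣q∣ {suc m} S₂))

  sizes-dominated : ∀ {k} → Sizes (ConnectedClusterDeletion H) k → ∃ λ j → Families j × j ≤ k
  sizes-dominated (S , deletion , refl) with Vec.splitAt (suc m) S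
  ... | S₁ , S₂ , refl = ++-dominated S₁ S₂ deletion

lemma24 : ∀ {m n} (G₁ : Graph (suc m)) (G₂ : Graph n) → IsComplete G₁ →
    ∀ a b c d → IsVarsigmaC (G₁ ∨ᴳ G₂) a → IsVarsigma G₂ b → IsThetaC G₂ c → IsTheta G₂ d →
    a ≡ min∞ (min∞ (just (suc m + b)) c) (just (1 + d))
lemma24 {m} G₁ G₂ complete a b c d ςᶜ ς θᶜ θ =
  IsMinimum-unique (MinSize⇒IsMinimum ςᶜ)
    (IsMinimum-coinitial families⊆sizes sizes-dominated
      (IsMinimum-∪ (IsMinimum-∪ (IsMinimum-+ˢ (suc m) (MinSize⇒IsMinimum ς)) (MinSize⇒IsMinimum θᶜ))
                   (IsMinimum-+ˢ 1 (MinSize⇒IsMinimum θ))))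
  where open CliqueJoin complete
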